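{- Let $m\ge 3$ be odd, let $s$ be an even positive integer not divisible by $4$, and let $n=sm$. Define automorphisms of $\Gamma=C_n[mK_1]$ $$\sigma_1=(1,1,\dots,1,tc^{ -1})r,\qquad \sigma_2=(t,\gamma_2,\gamma_3,\dots,\gamma_n)z,$$ where for $2\le i\le n$, $\gamma_i=c$ if $i\equiv 0$ or $3\pmod 4$ and $\gamma_i=c^{ -1}$ if $i\equiv1$ or $2\pmod 4$ (so $\sigma_2=(t,c^{ -1},c,c,c^{ -1},c^{ -1},\dots,c,c,c^{ -1},c^{ -1})z$), and let $G=\langle\sigma_1,\sigma_2\rangle$. Then $\sigma_1$ has order $2n$, $\sigma_2$ has order $2m$, $\sigma_1\sigma_2$ has order $2$, and $|G|=4m^2n$.
   Context: $C_n[mK_1]$ has vertex set $\{1,\dots,n\}\times\{1,\dots,m\}$ with $(i_1,j_1)\sim(i_2,j_2)$ iff $i_1\equiv i_2\pm1\pmod n$ (residues mod $n$ represented by $1,\dots,n$, mod $m$ by $1,\dots,m$). For $\alpha_i\in S_m$ and a permutation $x$ of $\{1,\dots,n\}$, $(\alpha_1,\dots,\alpha_n)x$ is the vertex permutation $(i,j)\mapsto(ix,j\alpha_i)$; permutations act on the right and products are composed left to right. $c=(1\,2\,\cdots\,m)$, $t\in S_m$ fixes $1$ and swaps $j\leftrightarrow m-j+2$ for $2\le j\le m$, $r=(1\,2\,\cdots\,n)$, and $z$ fixes $1$ and swaps $j\leftrightarrow n-j+2$ for $2\le j\le n$. -}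

module Defs where

open import Data.Nat using (ℕ; zero; suc; _+_; _*_; _∸_; _<_; _≡ᵇ_)
open import Data.Nat.DivMod using (_mod_; _%_)
open import Data.Fin using (Fin; toℕ)
open import Data.Product using (_×_; _,_; Σ; ∃)
open import Data.Bool using (if_then_else_; _∨_)
open import Relation.Binary.PropositionalEquality using (_≡_)
open import Relation.Nullary using (¬_)

-- Conventions: paper index i ∈ {1..n} is represented by (i-1) ∈ Fin n,
-- paper index j ∈ {1..m} by (j-1) ∈ Fin m.

-- reduction mod k; the argument of type Fin k witnesses k > 0
modOf : {k : ℕ} → Fin k → ℕ → Fin k
modOf {suc k} _ a = a mod (suc k)

cyc : {k : ℕ} → Fin k → Fin k
cyc {k} i = modOf i (suc (toℕ i))

cycInv : {k : ℕ} → Fin k → Fin k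
cycInv {suc k} i = (toℕ i + k) mod (suc k)

-- the reflection fixing 1 and swapping j ↔ k-j+2 (0-based: j' ↦ -j' mod k)
refl' : {k : ℕ} → Fin k → Fin k
refl' {k} i = modOf i (k ∸ toℕ i)

Vertex : ℕ → ℕ → Set
Vertex n m = Fin n × Fin m

Perm : ℕ → ℕ → Set
Perm n m = Vertex n m → Vertex n m

_≈_ : {n m : ℕ} → Perm n m → Perm n m → Set
f ≈ g = ∀ v → f v ≡ g v

idP : {n m : ℕ} → Perm n m
idP v = v

-- product composed left to right: (f · g) means first f, then g
_·_ : {n m : ℕ} → Perm n m → Perm n m → Perm n m
(f · g) v = g (f v)

_^_ : {n m : ℕ} → Perm n m → ℕ → Perm n m
f ^ zero = idP
f ^ suc k = (f ^ k) · f

HasOrder : {n m : ℕ} → Perm n m → ℕ → Set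
HasOrder f k = (0 < k) × ((f ^ k) ≈ idP) × (∀ j → 0 < j → j < k → ¬ ((f ^ j) ≈ idP))

-- (α_1,...,α_n)x : (i,j) ↦ (ix, jα_i)
act : {n m : ℕ} → (Fin n → Fin m → Fin m) → (Fin n → Fin n) → Perm n m
act α x (i , j) = (x i , α i j)

c : {m : ℕ} → Fin m → Fin m
c = cyc
cInv : {m : ℕ} → Fin m → Fin m
cInv = cycInv
t : {m : ℕ} → Fin m → Fin m
t = refl'
r : {n : ℕ} → Fin n → Fin n
r = cyc
z : {n : ℕ} → Fin n → Fin n
z = refl'

-- tc^{-1} (left to right: first t, then c^{-1})
tcInv : {m : ℕ} → Fin m → Fin m
tcInv j = cInv (t j)

σ₁ : (n m : ℕ) → Perm n m
σ₁ n m = act (λ i j → if (suc (toℕ i) ≡ᵇ n) then tcInv j else j) r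

γ : {m : ℕ} → ℕ → Fin m → Fin m
γ p = if ((p % 4 ≡ᵇ 0) ∨ (p % 4 ≡ᵇ 3)) then c else cInv

σ₂ : (n m : ℕ) → Perm n m
σ₂ n m = act (λ i → if (toℕ i ≡ᵇ 0) then t else γ (suc (toℕ i))) z

-- the subgroup generated by g₁, g₂ (in a finite permutation group the
-- submonoid generated equals the subgroup generated)
data Gen {n m : ℕ} (g₁ g₂ : Perm n m) : Perm n m → Set where
  gen-id : Gen g₁ g₂ idP
  gen-₁  : ∀ {f} → Gen g₁ g₂ f → Gen g₁ g₂ (f · g₁)
  gen-₂  : ∀ {f} → Gen g₁ g₂ f → Gen g₁ g₂ (f · g₂)

HasCard : {n m : ℕ} → (Perm n m → Set) → ℕ → Set
HasCard {n} {m} G N =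
  Σ (Fin N → Perm n m) λ e →
    (∀ k → G (e k)) ×
    (∀ k l → e k ≈ e l → k ≡ l) ×
    (∀ f → G f → ∃ λ k → f ≈ e k)

-- Unfold Γ = C_n[mK₁] onto ℤ²: the point (I, J) lies over the vertex in column I mod n and row J mod m
-- when I mod 2n < n, and over row mirror J = −1−J mod m otherwise (indices are 0-based, and mirror is tc⁻¹).
-- On this double cover σ₁ lifts to the translation (I, J) ↦ (I + 1, J), the twist tc⁻¹ at the last column
-- being exactly the change of sheet, and since n ≡ 2 (mod 4), σ₂ lifts to (I, J) ↦ (−I, −1−J − χ I), where
-- χ is the 4-periodic sign pattern (−1, −1, 1, 1) of the exponents of c in γ. So every element of G is
-- induced by an affine map (I, J) ↦ (±I + a, ±J + κ + u χ(I) + v χ(I + 1)), with parameters the two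
-- signs, a mod 2n and u, v mod m, up to the deck transformation (I, J) ↦ (I + n, −1−J). With a taken in
-- [0, n) these maps are told apart by three vertices, and each of them lies in G: σ₂² and its conjugate
-- by σ₁ shift (u, v) by (1, −1) and (1, 1), which generate (ℤ/m)² because m is odd. Hence |G| is
-- 2 · 2 · m² · n = 4m²n. The orders are read off the parameters: σ₁^k is the translation by k, σ₂^(2k)
-- shifts (u, v) by (k, −k) while odd powers of σ₂ reverse the columns, and (σ₁σ₂)² is the identity.

module Submission where

open import Data.Nat as ℕ using (ℕ; zero; suc; NonZero)
import Data.Nat.Properties as ℕ
import Data.Nat.DivMod as ℕ
import Data.Nat.Tactic.RingSolver as ℕ-Solver
open import Data.Nat.Divisibility using (divides)
import Data.Integer.Properties as ℤ
open import Data.Integer.DivMod using (a≡a%ℕn+[a/ℕn]*n; n%ℕd<d)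
open import Data.Integer.Tactic.RingSolver using (solve-∀)
open import Data.Fin as Fin using (Fin; toℕ; fromℕ<)
import Data.Fin.Properties as Fin
open import Data.Fin.Properties using (all?; 2↔Bool; *↔×)
open import Data.Fin.Patterns using (0F; 1F; 2F; 3F)
open import Data.Bool using (Bool; true; false; if_then_else_; _∨_; not; _xor_)
open import Data.Bool.Properties using (not-involutive)
open import Data.Product using (Σ; ∃; _,_; proj₁; proj₂; _×_)
open import Data.Product.Function.NonDependent.Propositional using (_×-↔_)
open import Data.Sum using (_⊎_; inj₁; inj₂)
open import Data.Empty using (⊥-elim)
open import Function using (_∘_)
open import Function.Bundles using (_↔_; Inverse)
open import Function.Properties.Inverse using (↔-refl; ↔-trans)
open import Relation.Nullary using (Dec; does; yes; no; ¬_; contradiction)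
open import Relation.Nullary.Decidable using (from-yes; dec-true; dec-false)
open import Relation.Binary.Bundles using (Setoid)
open import Relation.Binary.PropositionalEquality hiding (J)
open import Defs using (Vertex; Perm; _≈_; idP; _·_; _^_; HasOrder; HasCard; σ₁; σ₂; Gen; gen-id; gen-₁; gen-₂;
                        tcInv; cyc; cycInv; refl'; γ)

module Residues where

  open import Data.Integer using (ℤ; +_; -[1+_]; _+_; _*_; -_; _-_; _%ℕ_; _/ℕ_)

  infix 4 _≡_mod_
  record _≡_mod_ (a b : ℤ) (d : ℕ) : Set where
    constructor _,_
    field
      quotient : ℤ
      equation : a ≡ b + quotient * + d

  module _ {d : ℕ} where

    ≡⇒≡mod : ∀ {a b} → a ≡ b → a ≡ b mod d
    ≡⇒≡mod {a} refl = + 0 , sym (trans (cong (λ x → a + x) (ℤ.*-zeroˡ (+ d))) (ℤ.+-identityʳ a))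

    ≡mod-refl : ∀ {a} → a ≡ a mod d
    ≡mod-refl = ≡⇒≡mod refl

    ≡mod-sym : ∀ {a b} → a ≡ b mod d → b ≡ a mod d
    ≡mod-sym {b = b} (k , refl) = - k , ring b k (+ d)
      where ring : ∀ b k d → b ≡ b + k * d + - k * d
            ring = solve-∀

    ≡mod-trans : ∀ {a b c} → a ≡ b mod d → b ≡ c mod d → a ≡ c mod d
    ≡mod-trans {c = c} (k , refl) (l , refl) = l + k , ring c l k (+ d)
      where ring : ∀ c l k d → c + l * d + k * d ≡ c + (l + k) * d
            ring = solve-∀

    +-cong-mod : ∀ {a b a′ b′} → a ≡ b mod d → a′ ≡ b′ mod d → a + a′ ≡ b + b′ mod d
    +-cong-mod {b = b} {b′ = b′} (k , refl) (l , refl) = k + l , ring b b′ k l (+ d)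
      where ring : ∀ b b′ k l d → b + k * d + (b′ + l * d) ≡ b + b′ + (k + l) * d
            ring = solve-∀

    *-cong-mod : ∀ {a b a′ b′} → a ≡ b mod d → a′ ≡ b′ mod d → a * a′ ≡ b * b′ mod d
    *-cong-mod {b = b} {b′ = b′} (k , refl) (l , refl) = k * b′ + b * l + k * l * + d , ring b b′ k l (+ d)
      where ring : ∀ b b′ k l d → (b + k * d) * (b′ + l * d) ≡ b * b′ + (k * b′ + b * l + k * l * d) * d
            ring = solve-∀

    -‿cong-mod : ∀ {a b} → a ≡ b mod d → - a ≡ - b mod d
    -‿cong-mod {b = b} (k , refl) = - k , ring b k (+ d)
      where ring : ∀ b k d → - (b + k * d) ≡ - b + - k * d
            ring = solve-∀

    ≡mod-setoid : Setoid _ _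
    ≡mod-setoid = record
      { Carrier       = ℤ
      ; _≈_           = _≡_mod d
      ; isEquivalence = record { refl = ≡mod-refl ; sym = ≡mod-sym ; trans = ≡mod-trans }
      }

  ≡mod-weaken : ∀ {d e a b} → + d ≡ + 0 mod e → a ≡ b mod d → a ≡ b mod e
  ≡mod-weaken {d} {e} {b = b} (l , d≡le) (k , refl) = k * l , (begin
    b + k * + d              ≡⟨ cong (λ x → b + k * x) d≡le ⟩
    b + k * (+ 0 + l * + e)  ≡⟨ ring b k l (+ e) ⟩
    b + k * l * + e          ∎)
    where open ≡-Reasoning
          ring : ∀ b k l e → b + k * (+ 0 + l * e) ≡ b + k * l * e
          ring = solve-∀

  ℕ-≡mod : ∀ {a r q d} → a ≡ r ℕ.+ q ℕ.* d → + a ≡ + r mod d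
  ℕ-≡mod {r = r} {q} {d} refl = + q , trans (ℤ.pos-+ r (q ℕ.* d)) (cong (λ x → + r + x) (ℤ.pos-* q d))

  private
    no-positive-multiple : ∀ {d r₁ r₂} k → r₁ ℕ.< d → + r₁ ≢ + r₂ + + suc k * + d
    no-positive-multiple {d} {r₁} {r₂} k r₁<d eq = ℕ.<⇒≱ r₁<d (begin
      d                   ≤⟨ ℕ.m≤m+n d (k ℕ.* d) ⟩
      suc k ℕ.* d         ≤⟨ ℕ.m≤n+m _ r₂ ⟩
      r₂ ℕ.+ suc k ℕ.* d  ≡⟨ ℤ.+-injective (trans (_≡_mod_.equation (ℕ-≡mod {r = r₂} {suc k} {d} refl)) (sym eq)) ⟩
      r₁                  ∎)
      where open ℕ.≤-Reasoning

  ≡mod⇒≡ : ∀ {d r₁ r₂} → r₁ ℕ.< d → r₂ ℕ.< d → + r₁ ≡ + r₂ mod d → r₁ ≡ r₂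
  ≡mod⇒≡ {d} {r₂ = r₂} _ _ (+ zero , eq) = ℤ.+-injective (trans eq (ring (+ r₂) (+ d)))
    where ring : ∀ a d → a + + 0 * d ≡ a
          ring = solve-∀
  ≡mod⇒≡ r₁<d _ (+ suc k , eq) = ⊥-elim (no-positive-multiple k r₁<d eq)
  ≡mod⇒≡ {d} {r₂ = r₂} _ r₂<d (-[1+ k ] , eq) =
    ⊥-elim (no-positive-multiple k r₂<d (trans (ring (+ r₂) (+ suc k) (+ d)) (cong (λ x → x + + suc k * + d) (sym eq))))
    where ring : ∀ b k d → b ≡ b + (- k) * d + k * d
          ring = solve-∀

  module _ {d : ℕ} .⦃ _ : NonZero d ⦄ where

    %ℕ-≡mod : ∀ a → + (a %ℕ d) ≡ a mod d
    %ℕ-≡mod a = ≡mod-sym (a /ℕ d , a≡a%ℕn+[a/ℕn]*n a d)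

    ≡mod⇒%ℕ≡ : ∀ {a b} → a ≡ b mod d → a %ℕ d ≡ b %ℕ d
    ≡mod⇒%ℕ≡ {a} {b} a≡b = ≡mod⇒≡ (n%ℕd<d a d) (n%ℕd<d b d)
      (≡mod-trans (%ℕ-≡mod a) (≡mod-trans a≡b (≡mod-sym (%ℕ-≡mod b))))

    ≡residue⇒%ℕ≡ : ∀ {a r} → a ≡ + r mod d → r ℕ.< d → a %ℕ d ≡ r
    ≡residue⇒%ℕ≡ a≡r r<d = trans (≡mod⇒%ℕ≡ a≡r) (ℕ.m<n⇒m%n≡m r<d)

  infix 4 _represents_
  _represents_ : ∀ {d} → Fin d → ℤ → Set
  _represents_ {d} x X = + toℕ x ≡ X mod d

  module _ {d : ℕ} where

    represents-injective : ∀ {x y : Fin d} {X Y} → x represents X → y represents Y → X ≡ Y mod d → x ≡ y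
    represents-injective {x} {y} x~X y~Y X≡Y = Fin.toℕ-injective
      (≡mod⇒≡ (Fin.toℕ<n x) (Fin.toℕ<n y) (≡mod-trans x~X (≡mod-trans X≡Y (≡mod-sym y~Y))))

    residue-injective : ∀ {x y : Fin d} → + toℕ x ≡ + toℕ y mod d → x ≡ y
    residue-injective = represents-injective ≡mod-refl ≡mod-refl

    represents-≡mod : ∀ {x y : Fin d} {X Y} → x represents X → y represents Y → x ≡ y → X ≡ Y mod d
    represents-≡mod x~X y~Y refl = ≡mod-trans (≡mod-sym x~X) y~Y

  module _ {d : ℕ} .⦃ _ : NonZero d ⦄ where

    reduce : ℤ → Fin d
    reduce a = fromℕ< (n%ℕd<d a d)

    reduce-represents : ∀ a → reduce a represents a
    reduce-represents a = subst (λ r → + r ≡ a mod d) (sym (Fin.toℕ-fromℕ< (n%ℕd<d a d))) (%ℕ-≡mod a)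

    reduce-cong : ∀ {a b} → a ≡ b mod d → reduce a ≡ reduce b
    reduce-cong {a} {b} = represents-injective (reduce-represents a) (reduce-represents b)

    reduce-toℕ : ∀ x → reduce (+ toℕ x) ≡ x
    reduce-toℕ x = represents-injective (reduce-represents _) ≡mod-refl ≡mod-refl

    toℕ-reduce : ∀ {a r} → a ≡ + r mod d → r ℕ.< d → toℕ (reduce a) ≡ r
    toℕ-reduce {a} a≡r r<d = ≡mod⇒≡ (Fin.toℕ<n (reduce a)) r<d (≡mod-trans (reduce-represents a) a≡r)

    mod-represents : ∀ a → a ℕ.mod d represents + a
    mod-represents a = subst (λ r → + r ≡ + a mod d) (sym (Fin.toℕ-fromℕ< (ℕ.m%n<n a d))) (%ℕ-≡mod (+ a))

  pos-suc : ∀ a → + suc a ≡ + a + + 1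
  pos-suc a = trans (ℤ.pos-+ 1 a) (ℤ.+-comm (+ 1) (+ a))

  pos-∸ : ∀ {x k} → x ℕ.≤ k → + (k ℕ.∸ x) ≡ + k - + x
  pos-∸ {x} {k} x≤k = sym (trans (ℤ.m-n≡m⊖n k x) (ℤ.⊖-≥ x≤k))

  +1-cong : ∀ {d I r} → I ≡ + r mod d → I + + 1 ≡ + suc r mod d
  +1-cong I≡r = ≡mod-trans (+-cong-mod I≡r ≡mod-refl) (≡⇒≡mod (sym (pos-suc _)))

  cyc-represents : ∀ {d} {x : Fin d} {X} → x represents X → cyc x represents X + + 1
  cyc-represents {suc d} {x} {X} x~X = begin
    + toℕ (cyc x)  ≈⟨ mod-represents (suc (toℕ x)) ⟩
    + suc (toℕ x)  ≡⟨ pos-suc (toℕ x) ⟩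
    + toℕ x + + 1  ≈⟨ +-cong-mod x~X ≡mod-refl ⟩
    X + + 1        ∎
    where open import Relation.Binary.Reasoning.Setoid (≡mod-setoid {suc d})

  cycInv-represents : ∀ {d} {x : Fin d} {X} → x represents X → cycInv x represents X - + 1
  cycInv-represents {suc d} {x} {X} x~X = begin
    + toℕ (cycInv x)  ≈⟨ mod-represents (toℕ x ℕ.+ d) ⟩
    + (toℕ x ℕ.+ d)   ≡⟨ ℤ.pos-+ (toℕ x) d ⟩
    + toℕ x + + d     ≈⟨ +-cong-mod x~X (+ 1 , trans (ring (+ d)) (cong (λ y → - + 1 + + 1 * y) (sym (pos-suc d)))) ⟩
    X - + 1           ∎
    where open import Relation.Binary.Reasoning.Setoid (≡mod-setoid {suc d})
          ring : ∀ d → d ≡ - + 1 + + 1 * (d + + 1)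
          ring = solve-∀

  refl'-represents : ∀ {d} {x : Fin d} {X} → x represents X → refl' x represents - X
  refl'-represents {suc d} {x} {X} x~X = begin
    + toℕ (refl' x)      ≈⟨ mod-represents (suc d ℕ.∸ toℕ x) ⟩
    + (suc d ℕ.∸ toℕ x)  ≡⟨ pos-∸ (ℕ.<⇒≤ (Fin.toℕ<n x)) ⟩
    + suc d - + toℕ x    ≈⟨ +-cong-mod {b = + 0} (+ 1 , ring (+ suc d)) (-‿cong-mod x~X) ⟩
    + 0 - X              ≡⟨ ℤ.+-identityˡ (- X) ⟩
    - X                  ∎
    where open import Relation.Binary.Reasoning.Setoid (≡mod-setoid {suc d})
          ring : ∀ d → d ≡ + 0 + + 1 * d
          ring = solve-∀

  mirror : ℤ → ℤ
  mirror J = - J - + 1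

  mirror-involutive : ∀ J → mirror (mirror J) ≡ J
  mirror-involutive = ring
    where ring : ∀ J → - (- J - + 1) - + 1 ≡ J
          ring = solve-∀

  mirror-cong : ∀ {d J J′} → J ≡ J′ mod d → mirror J ≡ mirror J′ mod d
  mirror-cong J≡J′ = +-cong-mod (-‿cong-mod J≡J′) ≡mod-refl

  module _ {d : ℕ} .⦃ _ : NonZero d ⦄ where

    cyc-reduce : ∀ I → cyc (reduce {d} I) ≡ reduce (I + + 1)
    cyc-reduce I = represents-injective (cyc-represents (reduce-represents I)) (reduce-represents _) ≡mod-refl

    refl'-reduce : ∀ I → refl' (reduce {d} I) ≡ reduce (- I)
    refl'-reduce I = represents-injective (refl'-represents (reduce-represents I)) (reduce-represents _) ≡mod-refl

    tcInv-reduce : ∀ J → tcInv (reduce {d} J) ≡ reduce (mirror J)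
    tcInv-reduce J =
      represents-injective (cycInv-represents (refl'-represents (reduce-represents J))) (reduce-represents _) ≡mod-refl

  module _ (h : ℕ) where

    2*[2+h]≡1 : + 2 * + (2 ℕ.+ h) ≡ + 1 mod (3 ℕ.+ 2 ℕ.* h)
    2*[2+h]≡1 = ≡mod-trans (≡⇒≡mod (sym (ℤ.pos-* 2 (2 ℕ.+ h)))) (ℕ-≡mod {q = 1} (ring h))
      where ring : ∀ h → 2 ℕ.* (2 ℕ.+ h) ≡ 1 ℕ.+ 1 ℕ.* (3 ℕ.+ 2 ℕ.* h)
            ring = ℕ-Solver.solve-∀

    halve : ∀ {x y} → + 2 * x ≡ + 2 * y mod (3 ℕ.+ 2 ℕ.* h) → x ≡ y mod (3 ℕ.+ 2 ℕ.* h)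
    halve {x} {y} 2x≡2y = begin
      x                        ≡⟨ ring x ⟩
      + 1 * x                  ≈⟨ *-cong-mod (≡mod-sym 2*[2+h]≡1) (≡mod-refl {a = x}) ⟩
      + 2 * + (2 ℕ.+ h) * x    ≡⟨ swap (+ (2 ℕ.+ h)) x ⟩
      + (2 ℕ.+ h) * (+ 2 * x)  ≈⟨ *-cong-mod (≡mod-refl {a = + (2 ℕ.+ h)}) 2x≡2y ⟩
      + (2 ℕ.+ h) * (+ 2 * y)  ≡⟨ swap (+ (2 ℕ.+ h)) y ⟨
      + 2 * + (2 ℕ.+ h) * y    ≈⟨ *-cong-mod 2*[2+h]≡1 (≡mod-refl {a = y}) ⟩
      + 1 * y                  ≡⟨ ring y ⟨
      y                        ∎
      where open import Relation.Binary.Reasoning.Setoid (≡mod-setoid {3 ℕ.+ 2 ℕ.* h})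
            ring : ∀ x → x ≡ + 1 * x
            ring = solve-∀
            swap : ∀ a x → + 2 * a * x ≡ a * (+ 2 * x)
            swap = solve-∀

open Residues

module SignPattern where

  open import Data.Integer using (ℤ; +_; _+_; _*_; -_)

  -- χ₄ i is the exponent of c in γ_(i+1), read in the 0-based column i.
  χ₄ : Fin 4 → ℤ
  χ₄ 0F = - + 1
  χ₄ 1F = - + 1
  χ₄ 2F = + 1
  χ₄ 3F = + 1

  χ : ℤ → ℤ
  χ I = χ₄ (reduce I)

  χ-cong : ∀ {I I′} → I ≡ I′ mod 4 → χ I ≡ χ I′
  χ-cong I≡I′ = cong χ₄ (reduce-cong I≡I′)

  χ-+2 : ∀ I → χ (I + + 2) ≡ - χ I
  χ-+2 I = trans (χ-cong (+-cong-mod (≡mod-sym (reduce-represents I)) ≡mod-refl)) (table (reduce I))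
    where table : ∀ ρ → χ (+ toℕ ρ + + 2) ≡ - χ₄ ρ
          table 0F = refl
          table 1F = refl
          table 2F = refl
          table 3F = refl

  γ-represents : ∀ {d} r {x : Fin d} {X} → x represents X → γ (suc r) x represents X + χ (+ r)
  γ-represents r {x} {X} x~X = subst₂ (λ f k → f x represents X + k)
    (sym (cong (λ k → if (k ℕ.≡ᵇ 0) ∨ (k ℕ.≡ᵇ 3) then cyc else cycInv) (ℕ.%-distribˡ-+ 1 r 4)))
    (χ-cong (%ℕ-≡mod (+ r)))
    (residue (r ℕ.% 4) (ℕ.m%n<n r 4))
    where residue : ∀ ρ → ρ ℕ.< 4 → γ (suc ρ) x represents X + χ (+ ρ)
          residue 0 _ = cycInv-represents x~X
          residue 1 _ = cycInv-represents x~X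
          residue 2 _ = cyc-represents x~X
          residue 3 _ = cyc-represents x~X
          residue (suc (suc (suc (suc _)))) (ℕ.s≤s (ℕ.s≤s (ℕ.s≤s (ℕ.s≤s ()))))

  sign : Bool → ℤ
  sign true  = + 1
  sign false = - + 1

  sign-not : ∀ b → sign (not b) ≡ - sign b
  sign-not true  = refl
  sign-not false = refl

  sign-injective : ∀ {d} → 3 ℕ.≤ d → ∀ b b′ → sign b ≡ sign b′ mod d → b ≡ b′
  sign-injective _ true  true  _ = refl
  sign-injective _ false false _ = refl
  sign-injective (ℕ.s≤s (ℕ.s≤s (ℕ.s≤s _))) true false 1≡-1 with ≡mod⇒%ℕ≡ 1≡-1
  ... | ()
  sign-injective (ℕ.s≤s (ℕ.s≤s (ℕ.s≤s _))) false true -1≡1 with ≡mod⇒%ℕ≡ -1≡1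
  ... | ()

  -- The coefficients of χ (± I + a), for a mod 4, in the basis χ I, χ (I + 1) of the f with f (I + 2) = - f I.
  expand₀ expand₁ : Bool → Fin 4 → ℤ
  expand₀ true  0F = + 1
  expand₀ true  2F = - + 1
  expand₀ false 1F = + 1
  expand₀ false 3F = - + 1
  expand₀ _     _  = + 0
  expand₁ true  1F = + 1
  expand₁ true  3F = - + 1
  expand₁ false 0F = + 1
  expand₁ false 2F = - + 1
  expand₁ _     _  = + 0

  private
    χ-affine-lhs χ-affine-rhs : Bool → Fin 4 → Fin 4 → ℤ
    χ-affine-lhs e ρa ρi = χ (sign e * + toℕ ρi + + toℕ ρa)
    χ-affine-rhs e ρa ρi = expand₀ e ρa * χ₄ ρi + expand₁ e ρa * χ (+ toℕ ρi + + 1)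

    χ-affine-table : ∀ e ρa ρi → χ-affine-lhs e ρa ρi ≡ χ-affine-rhs e ρa ρi
    χ-affine-table true  = from-yes (all? λ ρa → all? λ ρi → χ-affine-lhs true ρa ρi ℤ.≟ χ-affine-rhs true ρa ρi)
    χ-affine-table false = from-yes (all? λ ρa → all? λ ρi → χ-affine-lhs false ρa ρi ℤ.≟ χ-affine-rhs false ρa ρi)

  χ-affine : ∀ e a I → χ (sign e * I + a) ≡ expand₀ e (reduce a) * χ I + expand₁ e (reduce a) * χ (I + + 1)
  χ-affine e a I = begin
    χ (sign e * I + a)
      ≡⟨ χ-cong (+-cong-mod (*-cong-mod (≡mod-refl {a = sign e}) (≡mod-sym (reduce-represents I)))
                            (≡mod-sym (reduce-represents a))) ⟩
    χ-affine-lhs e (reduce a) (reduce I)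
      ≡⟨ χ-affine-table e (reduce a) (reduce I) ⟩
    A * χ I + B * χ (+ toℕ (reduce I) + + 1)
      ≡⟨ cong (λ k → A * χ I + B * k) (χ-cong (+-cong-mod (reduce-represents I) ≡mod-refl)) ⟩
    A * χ I + B * χ (I + + 1) ∎
    where open ≡-Reasoning
          A B : ℤ
          A = expand₀ e (reduce a)
          B = expand₁ e (reduce a)

open SignPattern

even⊎odd : ∀ j → ∃ λ k → j ≡ k ℕ.+ k ⊎ j ≡ suc (k ℕ.+ k)
even⊎odd zero = 0 , inj₁ refl
even⊎odd (suc j) with even⊎odd j
... | k , inj₁ j≡2k   = k , inj₂ (cong suc j≡2k)
... | k , inj₂ j≡2k+1 = suc k , inj₁ (trans (cong suc j≡2k+1) (sym (cong suc (ℕ.+-suc k k))))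

hasCard-via : ∀ {n m N} {A : Set} {G : Perm n m → Set} (⟦_⟧ : A → Perm n m) → Fin N ↔ A →
              (∀ x y → ⟦ x ⟧ ≈ ⟦ y ⟧ → x ≡ y) →
              (∀ x → Σ (Perm n m) λ f → G f × f ≈ ⟦ x ⟧) →
              (∀ f → G f → ∃ λ x → f ≈ ⟦ x ⟧) →
              HasCard G N
hasCard-via {n} {m} {N} {G = G} ⟦_⟧ Fin↔A injective realise cover =
  element , proj₁ ∘ proj₂ ∘ realise ∘ to , distinct , complete
  where
    open Inverse Fin↔A using (to; from; strictlyInverseˡ; strictlyInverseʳ)
    element : Fin N → Perm n m
    element = proj₁ ∘ realise ∘ to
    realises : ∀ k → element k ≈ ⟦ to k ⟧
    realises = proj₂ ∘ proj₂ ∘ realise ∘ to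
    distinct : ∀ k l → element k ≈ element l → k ≡ l
    distinct k l eq = begin
      k            ≡⟨ strictlyInverseʳ k ⟨
      from (to k)  ≡⟨ cong from (injective (to k) (to l) λ w → trans (sym (realises k w)) (trans (eq w) (realises l w))) ⟩
      from (to l)  ≡⟨ strictlyInverseʳ l ⟩
      l            ∎
      where open ≡-Reasoning
    complete : ∀ f → G f → ∃ λ k → f ≈ element k
    complete f Gf with cover f Gf
    ... | x , f≈x = from x , λ w → trans (f≈x w)
                      (trans (cong (λ y → ⟦ y ⟧ w) (sym (strictlyInverseˡ x))) (sym (realises (from x) w)))

module Cover (n m : ℕ) .⦃ _ : NonZero n ⦄ .⦃ _ : NonZero m ⦄ where

  open import Data.Integer using (ℤ; +_; _+_; _*_; -_; _-_; _%ℕ_)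

  2n : ℕ
  2n = n ℕ.+ n

  instance
    2n-nonZero : NonZero 2n
    2n-nonZero = ℕ.>-nonZero (ℕ.<-≤-trans (ℕ.>-nonZero⁻¹ n) (ℕ.m≤m+n n n))

  0<n : 0 ℕ.< n
  0<n = ℕ.>-nonZero⁻¹ n

  2n≡0 : + 2n ≡ + 0 mod 2n
  2n≡0 = ℕ-≡mod {q = 1} (sym (ℕ.*-identityˡ 2n))

  ≡mod-2n⇒≡mod-n : ∀ {I I′} → I ≡ I′ mod 2n → I ≡ I′ mod n
  ≡mod-2n⇒≡mod-n = ≡mod-weaken (ℕ-≡mod {q = 2} (cong (n ℕ.+_) (sym (ℕ.+-identityʳ n))))

  n+r≡r : ∀ r → + (n ℕ.+ r) ≡ + r mod n
  n+r≡r r = ℕ-≡mod {q = 1} (trans (ℕ.+-comm n r) (cong (r ℕ.+_) (sym (ℕ.*-identityˡ n))))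

  neg-lower : ∀ {r} → r ℕ.≤ n → - + r ≡ + (n ℕ.+ (n ℕ.∸ r)) mod 2n
  neg-lower {r} r≤n = - + 1 , (begin
    - + r                                    ≡⟨ ring (+ n) (+ r) ⟩
    + n + (+ n - + r) + - + 1 * (+ n + + n)  ≡⟨ cong₂ (λ x y → x + - + 1 * y) (sym n+[n∸r]) (sym (ℤ.pos-+ n n)) ⟩
    + (n ℕ.+ (n ℕ.∸ r)) + - + 1 * + 2n       ∎)
    where open ≡-Reasoning
          n+[n∸r] : + (n ℕ.+ (n ℕ.∸ r)) ≡ + n + (+ n - + r)
          n+[n∸r] = trans (ℤ.pos-+ n _) (cong (λ x → + n + x) (pos-∸ r≤n))
          ring : ∀ n r → - r ≡ n + (n - r) + - + 1 * (n + n)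
          ring = solve-∀

  neg-upper : ∀ {r} → r ℕ.≤ n → - + (n ℕ.+ r) ≡ + (n ℕ.∸ r) mod 2n
  neg-upper {r} r≤n = - + 1 , (begin
    - + (n ℕ.+ r)                    ≡⟨ cong -_ (ℤ.pos-+ n r) ⟩
    - (+ n + + r)                    ≡⟨ ring (+ n) (+ r) ⟩
    + n - + r + - + 1 * (+ n + + n)  ≡⟨ cong₂ (λ x y → x + - + 1 * y) (sym (pos-∸ r≤n)) (sym (ℤ.pos-+ n n)) ⟩
    + (n ℕ.∸ r) + - + 1 * + 2n       ∎)
    where open ≡-Reasoning
          ring : ∀ n r → - (n + r) ≡ n - r + - + 1 * (n + n)
          ring = solve-∀

  onUpperSheet : ℤ → Bool
  onUpperSheet I = does (n ℕ.≤? I %ℕ 2n)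

  onUpperSheet-cong : ∀ {I I′} → I ≡ I′ mod 2n → onUpperSheet I ≡ onUpperSheet I′
  onUpperSheet-cong I≡I′ = cong (λ r → does (n ℕ.≤? r)) (≡mod⇒%ℕ≡ I≡I′)

  data Sheet (I : ℤ) : Set where
    lower : ∀ {r} → r ℕ.< n → I ≡ + r mod 2n → Sheet I
    upper : ∀ {r} → r ℕ.< n → I ≡ + (n ℕ.+ r) mod 2n → Sheet I

  sheet : ∀ I → Sheet I
  sheet I with I %ℕ 2n ℕ.<? n
  ... | yes r<n = lower r<n (≡mod-sym (%ℕ-≡mod I))
  ... | no  r≮n = upper r∸n<n (≡mod-trans (≡mod-sym (%ℕ-≡mod I)) (≡⇒≡mod (cong +_ (sym n+[r∸n]≡r))))
    where n+[r∸n]≡r : n ℕ.+ (I %ℕ 2n ℕ.∸ n) ≡ I %ℕ 2n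
          n+[r∸n]≡r = ℕ.m+[n∸m]≡n (ℕ.≮⇒≥ r≮n)
          r∸n<n : I %ℕ 2n ℕ.∸ n ℕ.< n
          r∸n<n = ℕ.+-cancelˡ-< n _ n (subst (ℕ._< 2n) (sym n+[r∸n]≡r) (n%ℕd<d I 2n))

  lower⇒onUpperSheet≡false : ∀ {I r} → I ≡ + r mod 2n → r ℕ.< n → onUpperSheet I ≡ false
  lower⇒onUpperSheet≡false I≡r r<n =
    trans (cong (λ k → does (n ℕ.≤? k)) (≡residue⇒%ℕ≡ I≡r (ℕ.<-≤-trans r<n (ℕ.m≤m+n n n))))
          (dec-false (n ℕ.≤? _) (ℕ.<⇒≱ r<n))

  upper⇒onUpperSheet≡true : ∀ {I r} → I ≡ + (n ℕ.+ r) mod 2n → r ℕ.< n → onUpperSheet I ≡ true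
  upper⇒onUpperSheet≡true I≡n+r r<n =
    trans (cong (λ k → does (n ℕ.≤? k)) (≡residue⇒%ℕ≡ I≡n+r (ℕ.+-monoʳ-< n r<n)))
          (dec-true (n ℕ.≤? _) (ℕ.m≤m+n n _))

  row : Bool → ℤ → Fin m
  row false J = reduce J
  row true  J = reduce (mirror J)

  π : ℤ → ℤ → Vertex n m
  π I J = reduce I , row (onUpperSheet I) J

  row-cong : ∀ b {J J′} → J ≡ J′ mod m → row b J ≡ row b J′
  row-cong false J≡J′ = reduce-cong J≡J′
  row-cong true  J≡J′ = reduce-cong (mirror-cong J≡J′)

  row-injective : ∀ b {J J′} → row b J ≡ row b J′ → J ≡ J′ mod m
  row-injective false {J} {J′} eq = represents-≡mod (reduce-represents J) (reduce-represents J′) eq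
  row-injective true  {J} {J′} eq = subst₂ (λ x y → x ≡ y mod m) (mirror-involutive J) (mirror-involutive J′)
    (mirror-cong (represents-≡mod (reduce-represents (mirror J)) (reduce-represents (mirror J′)) eq))

  π-cong : ∀ {I I′ J J′} → I ≡ I′ mod 2n → J ≡ J′ mod m → π I J ≡ π I′ J′
  π-cong {I} {J′ = J′} I≡I′ J≡J′ = cong₂ _,_ (reduce-cong (≡mod-2n⇒≡mod-n I≡I′))
    (trans (row-cong (onUpperSheet I) J≡J′) (cong (λ b → row b J′) (onUpperSheet-cong I≡I′)))

  π-column : ∀ {I I′ J J′} → π I J ≡ π I′ J′ → I ≡ I′ mod n
  π-column {I} {I′} eq = represents-≡mod (reduce-represents I) (reduce-represents I′) (cong proj₁ eq)

  π-row : ∀ {I I′ J J′} → onUpperSheet I ≡ onUpperSheet I′ → π I J ≡ π I′ J′ → J ≡ J′ mod m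
  π-row {I} {J′ = J′} same-sheet eq =
    row-injective (onUpperSheet I) (trans (cong proj₂ eq) (cong (λ b → row b J′) (sym same-sheet)))

  π-toℕ : ∀ (i : Fin n) (j : Fin m) → π (+ toℕ i) (+ toℕ j) ≡ (i , j)
  π-toℕ i j = cong₂ _,_ (reduce-toℕ i)
    (trans (cong (λ b → row b (+ toℕ j)) (lower⇒onUpperSheet≡false ≡mod-refl (Fin.toℕ<n i))) (reduce-toℕ j))

  wraps : Fin n → Bool
  wraps i = suc (toℕ i) ℕ.≡ᵇ n

  wraps-reduce : ∀ {I r} → I ≡ + r mod n → r ℕ.< n → wraps (reduce I) ≡ does (suc r ℕ.≟ n)
  wraps-reduce I≡r r<n = cong (λ k → suc k ℕ.≡ᵇ n) (toℕ-reduce I≡r r<n)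

  onUpperSheet-+1 : ∀ I → onUpperSheet (I + + 1) ≡ onUpperSheet I xor wraps (reduce I)
  onUpperSheet-+1 I with sheet I
  ... | lower {r} r<n I≡r = trans (step (suc r ℕ.≟ n))
          (sym (cong₂ _xor_ (lower⇒onUpperSheet≡false I≡r r<n) (wraps-reduce (≡mod-2n⇒≡mod-n I≡r) r<n)))
    where step : (d : Dec (suc r ≡ n)) → onUpperSheet (I + + 1) ≡ does d
          step (yes 1+r≡n) = upper⇒onUpperSheet≡true
            (≡mod-trans (+1-cong I≡r) (≡⇒≡mod (cong +_ (trans 1+r≡n (sym (ℕ.+-identityʳ n)))))) 0<n
          step (no 1+r≢n) = lower⇒onUpperSheet≡false (+1-cong I≡r) (ℕ.≤∧≢⇒< r<n 1+r≢n)
  ... | upper {r} r<n I≡n+r = trans (step (suc r ℕ.≟ n))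
          (sym (cong₂ _xor_ (upper⇒onUpperSheet≡true I≡n+r r<n)
                            (wraps-reduce (≡mod-trans (≡mod-2n⇒≡mod-n I≡n+r) (n+r≡r r)) r<n)))
    where step : (d : Dec (suc r ≡ n)) → onUpperSheet (I + + 1) ≡ not (does d)
          step (yes 1+r≡n) = lower⇒onUpperSheet≡false
            (≡mod-trans (+1-cong I≡n+r)
                        (≡mod-trans (≡⇒≡mod (cong +_ (trans (sym (ℕ.+-suc n r)) (cong (n ℕ.+_) 1+r≡n)))) 2n≡0))
            0<n
          step (no 1+r≢n) = upper⇒onUpperSheet≡true
            (≡mod-trans (+1-cong I≡n+r) (≡⇒≡mod (cong +_ (sym (ℕ.+-suc n r))))) (ℕ.≤∧≢⇒< r<n 1+r≢n)

  row-wrap : ∀ b w J → (if w then tcInv (row b J) else row b J) ≡ row (b xor w) J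
  row-wrap false false J = refl
  row-wrap true  false J = refl
  row-wrap false true  J = tcInv-reduce J
  row-wrap true  true  J = trans (tcInv-reduce (mirror J)) (cong reduce (mirror-involutive J))

  σ₁-lift : ∀ I J → σ₁ n m (π I J) ≡ π (I + + 1) J
  σ₁-lift I J = cong₂ _,_ (cyc-reduce I)
    (trans (row-wrap (onUpperSheet I) (wraps (reduce I)) J) (cong (λ b → row b J) (sym (onUpperSheet-+1 I))))

  onUpperSheet-+n : ∀ I → onUpperSheet (I + + n) ≡ not (onUpperSheet I)
  onUpperSheet-+n I with sheet I
  ... | lower {r} r<n I≡r = trans
          (upper⇒onUpperSheet≡true (≡mod-trans (+-cong-mod I≡r (≡mod-refl {a = + n})) (≡⇒≡mod r+n≡n+r)) r<n)
          (cong not (sym (lower⇒onUpperSheet≡false I≡r r<n)))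
    where r+n≡n+r : + r + + n ≡ + (n ℕ.+ r)
          r+n≡n+r = trans (ℤ.+-comm (+ r) (+ n)) (sym (ℤ.pos-+ n r))
  ... | upper {r} r<n I≡n+r = trans
          (lower⇒onUpperSheet≡false (≡mod-trans (+-cong-mod I≡n+r (≡mod-refl {a = + n})) n+r+n≡r) r<n)
          (cong not (sym (upper⇒onUpperSheet≡true I≡n+r r<n)))
    where n+r+n≡r : + (n ℕ.+ r) + + n ≡ + r mod 2n
          n+r+n≡r = ≡mod-trans (≡⇒≡mod (sym (ℤ.pos-+ (n ℕ.+ r) n)))
                               (ℕ-≡mod {q = 1} (ring n r))
            where ring : ∀ n r → n ℕ.+ r ℕ.+ n ≡ r ℕ.+ 1 ℕ.* (n ℕ.+ n)
                  ring = ℕ-Solver.solve-∀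

  row-not-mirror : ∀ b J → row (not b) (mirror J) ≡ row b J
  row-not-mirror false J = cong reduce (mirror-involutive J)
  row-not-mirror true  J = refl

  π-deck : ∀ I J → π (I + + n) (mirror J) ≡ π I J
  π-deck I J = cong₂ _,_ (reduce-cong {b = I} (+ 1 , cong (λ k → I + k) (sym (ℤ.*-identityˡ (+ n)))))
    (trans (cong (λ b → row b (mirror J)) (onUpperSheet-+n I)) (row-not-mirror (onUpperSheet I) J))

  -- sign δ * J + κ δ is J when δ holds and mirror J otherwise.
  κ : Bool → ℤ
  κ true  = + 0
  κ false = - + 1

  κ-not : ∀ b → κ (not b) ≡ mirror (κ b)
  κ-not true  = refl
  κ-not false = refl

  record Affine : Set where
    constructor affine
    field
      ε : Bool
      a : ℤ
      δ : Bool
      u v : ℤ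

  column : Affine → ℤ → ℤ
  column (affine ε a _ _ _) I = sign ε * I + a

  height : Affine → ℤ → ℤ → ℤ
  height (affine _ _ δ u v) I J = sign δ * J + κ δ + u * χ I + v * χ (I + + 1)

  ⟦_⟧ : Affine → Perm n m
  ⟦ p ⟧ (i , j) = π (column p (+ toℕ i)) (height p (+ toℕ i) (+ toℕ j))

  ⟦⟧-cong : ∀ ε δ {a a′ u u′ v v′} → a ≡ a′ mod 2n → u ≡ u′ mod m → v ≡ v′ mod m →
            ⟦ affine ε a δ u v ⟧ ≈ ⟦ affine ε a′ δ u′ v′ ⟧
  ⟦⟧-cong ε δ a≡a′ u≡u′ v≡v′ (i , j) = π-cong (+-cong-mod (≡mod-refl {a = sign ε * I}) a≡a′)
    (+-cong-mod (+-cong-mod (≡mod-refl {a = sign δ * + toℕ j + κ δ}) (*-cong-mod u≡u′ (≡mod-refl {a = χ I})))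
                (*-cong-mod v≡v′ (≡mod-refl {a = χ (I + + 1)})))
    where I : ℤ
          I = + toℕ i

  ⟦⟧-column : ∀ p p′ → ⟦ p ⟧ ≈ ⟦ p′ ⟧ → ∀ i j → column p (+ toℕ i) ≡ column p′ (+ toℕ i) mod n
  ⟦⟧-column p p′ p≈p′ i j =
    π-column {column p I} {column p′ I} {height p I (+ toℕ j)} {height p′ I (+ toℕ j)} (p≈p′ (i , j))
    where I : ℤ
          I = + toℕ i

  ⟦⟧-height : ∀ p p′ → ⟦ p ⟧ ≈ ⟦ p′ ⟧ → ∀ i j → column p (+ toℕ i) ≡ column p′ (+ toℕ i) mod 2n →
              height p (+ toℕ i) (+ toℕ j) ≡ height p′ (+ toℕ i) (+ toℕ j) mod m
  ⟦⟧-height p p′ p≈p′ i j same-column =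
    π-row {column p I} {column p′ I} {height p I J} {height p′ I J} (onUpperSheet-cong same-column) (p≈p′ (i , j))
    where I : ℤ
          I = + toℕ i
          J : ℤ
          J = + toℕ j

  identity : Affine
  identity = affine true (+ 0) true (+ 0) (+ 0)

  ⟦identity⟧ : ⟦ identity ⟧ ≈ idP
  ⟦identity⟧ (i , j) = trans (π-cong (≡⇒≡mod (ring₁ I)) (≡⇒≡mod (ring₂ (+ toℕ j) (χ I) (χ (I + + 1))))) (π-toℕ i j)
    where I : ℤ
          I = + toℕ i
          ring₁ : ∀ I → + 1 * I + + 0 ≡ I
          ring₁ = solve-∀
          ring₂ : ∀ J x y → + 1 * J + + 0 + + 0 * x + + 0 * y ≡ J
          ring₂ = solve-∀

  deck : Affine → Affine
  deck (affine ε a δ u v) = affine ε (a + + n) (not δ) (- u) (- v)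

  height-not : ∀ ε a δ u v I J → height (affine ε a (not δ) (- u) (- v)) I J ≡ mirror (height (affine ε a δ u v) I J)
  height-not _ _ δ u v I J = begin
    sign (not δ) * J + κ (not δ) + - u * χ I + - v * χ (I + + 1)
      ≡⟨ cong₂ (λ x y → x * J + y + - u * χ I + - v * χ (I + + 1)) (sign-not δ) (κ-not δ) ⟩
    - sign δ * J + mirror (κ δ) + - u * χ I + - v * χ (I + + 1)
      ≡⟨ ring (sign δ) (κ δ) J u v (χ I) (χ (I + + 1)) ⟩
    mirror (sign δ * J + κ δ + u * χ I + v * χ (I + + 1)) ∎
    where open ≡-Reasoning
          ring : ∀ s k J u v x y → - s * J + (- k - + 1) + - u * x + - v * y ≡ - (s * J + k + u * x + v * y) - + 1
          ring = solve-∀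

  ⟦deck⟧ : ∀ p → ⟦ deck p ⟧ ≈ ⟦ p ⟧
  ⟦deck⟧ (affine ε a δ u v) (i , j) =
    trans (π-cong (≡⇒≡mod (sym (ℤ.+-assoc (sign ε * I) a (+ n)))) (≡⇒≡mod (height-not ε a δ u v I (+ toℕ j))))
          (π-deck (sign ε * I + a) _)
    where I : ℤ
          I = + toℕ i

  _·σ₁ : Affine → Affine
  affine ε a δ u v ·σ₁ = affine ε (a + + 1) δ u v

  ⟦⟧-·σ₁ : ∀ p → (⟦ p ⟧ · σ₁ n m) ≈ ⟦ p ·σ₁ ⟧
  ⟦⟧-·σ₁ p@(affine ε a δ u v) (i , j) = trans (σ₁-lift (column p I) J)
    (π-cong (≡⇒≡mod (ℤ.+-assoc (sign ε * I) a (+ 1))) (≡mod-refl {a = J}))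
    where I : ℤ
          I = + toℕ i
          J : ℤ
          J = height p I (+ toℕ j)

  module σ₂-Cover (n%4≡2 : n ℕ.% 4 ≡ 2) where

    n≡2 : + n ≡ + 2 mod 4
    n≡2 = ≡mod-trans (≡mod-sym (%ℕ-≡mod (+ n))) (≡⇒≡mod (cong +_ n%4≡2))

    χ-2n : ∀ {I I′} → I ≡ I′ mod 2n → χ I ≡ χ I′
    χ-2n = χ-cong ∘ ≡mod-weaken 4∣2n
      where 4∣2n : + 2n ≡ + 0 mod 4
            4∣2n = ≡mod-trans (≡⇒≡mod (ℤ.pos-+ n n)) (≡mod-trans (+-cong-mod n≡2 n≡2) (+ 1 , refl))

    χ-upper : ∀ {I r} → I ≡ + (n ℕ.+ r) mod 2n → χ I ≡ - χ (+ r)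
    χ-upper {I} {r} I≡n+r = begin
      χ I            ≡⟨ χ-2n I≡n+r ⟩
      χ (+ (n ℕ.+ r)) ≡⟨ cong χ (trans (ℤ.pos-+ n r) (ℤ.+-comm (+ n) (+ r))) ⟩
      χ (+ r + + n)  ≡⟨ χ-cong (+-cong-mod (≡mod-refl {a = + r}) n≡2) ⟩
      χ (+ r + + 2)  ≡⟨ χ-+2 (+ r) ⟩
      - χ (+ r)      ∎
      where open ≡-Reasoning

    σ₂-column : Fin n → Fin m → Fin m
    σ₂-column i = if toℕ i ℕ.≡ᵇ 0 then refl' else γ (suc (toℕ i))

    σ₂-column-0 : ∀ {i x X} → toℕ i ≡ 0 → x represents X → σ₂-column i x represents - X
    σ₂-column-0 {x = x} {X} i≡0 x~X =
      subst (λ k → (if k ℕ.≡ᵇ 0 then refl' else γ (suc k)) x represents - X) (sym i≡0) (refl'-represents x~X)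

    σ₂-column-suc : ∀ {i r x X} → toℕ i ≡ suc r → x represents X → σ₂-column i x represents X + χ (+ suc r)
    σ₂-column-suc {r = r} {x} {X} i≡1+r x~X =
      subst (λ k → (if k ℕ.≡ᵇ 0 then refl' else γ (suc k)) x represents X + χ (+ suc r)) (sym i≡1+r)
            (γ-represents (suc r) x~X)

    rows-agree : ∀ I J {b b′ Y} → onUpperSheet I ≡ b → onUpperSheet (- I) ≡ b′ →
                 σ₂-column (reduce I) (row b J) represents Y → row b′ (mirror J - χ I) represents Y →
                 σ₂-column (reduce I) (row (onUpperSheet I) J) ≡ row (onUpperSheet (- I)) (mirror J - χ I)
    rows-agree _ _ refl refl y y′ = represents-injective y y′ ≡mod-refl

    σ₂-lift-row : ∀ {I} J → Sheet I →
                  σ₂-column (reduce I) (row (onUpperSheet I) J) ≡ row (onUpperSheet (- I)) (mirror J - χ I)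
    σ₂-lift-row {I} J (lower {zero} _ I≡0) = rows-agree I J
      (lower⇒onUpperSheet≡false I≡0 0<n)
      (lower⇒onUpperSheet≡false (-‿cong-mod I≡0) 0<n)
      (σ₂-column-0 (toℕ-reduce (≡mod-2n⇒≡mod-n I≡0) 0<n) (reduce-represents J))
      (≡mod-trans (reduce-represents _) (≡⇒≡mod (trans (cong (λ x → mirror J - x) (χ-2n I≡0)) (ring J))))
      where ring : ∀ J → - J - + 1 - - + 1 ≡ - J
            ring = solve-∀
    σ₂-lift-row {I} J (lower {suc r} r<n I≡r) = rows-agree I J
      (lower⇒onUpperSheet≡false I≡r r<n)
      (upper⇒onUpperSheet≡true (≡mod-trans (-‿cong-mod I≡r) (neg-lower (ℕ.<⇒≤ r<n)))
                               (ℕ.∸-monoʳ-< ℕ.z<s (ℕ.<⇒≤ r<n)))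
      (≡mod-trans (σ₂-column-suc (toℕ-reduce (≡mod-2n⇒≡mod-n I≡r) r<n) (reduce-represents J))
                  (≡⇒≡mod (cong (λ x → J + x) (sym (χ-2n I≡r)))))
      (≡mod-trans (reduce-represents _) (≡⇒≡mod (ring J (χ I))))
      where ring : ∀ J x → - (- J - + 1 - x) - + 1 ≡ J + x
            ring = solve-∀
    σ₂-lift-row {I} J (upper {zero} _ I≡n) = rows-agree I J
      (upper⇒onUpperSheet≡true I≡n 0<n)
      (upper⇒onUpperSheet≡true (≡mod-trans (-‿cong-mod I≡n) (≡mod-trans (neg-upper ℕ.z≤n) n≡n+0)) 0<n)
      (σ₂-column-0 (toℕ-reduce (≡mod-trans (≡mod-2n⇒≡mod-n I≡n) (n+r≡r 0)) 0<n) (reduce-represents (mirror J)))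
      (≡mod-trans (reduce-represents _) (≡⇒≡mod (trans (cong (λ x → mirror (mirror J - x)) (χ-upper I≡n)) (ring J))))
      where n≡n+0 : + n ≡ + (n ℕ.+ 0) mod 2n
            n≡n+0 = ≡⇒≡mod (cong +_ (sym (ℕ.+-identityʳ n)))
            ring : ∀ J → - (- J - + 1 - - - + 1) - + 1 ≡ - (- J - + 1)
            ring = solve-∀
    σ₂-lift-row {I} J (upper {suc r} r<n I≡n+r) = rows-agree I J
      (upper⇒onUpperSheet≡true I≡n+r r<n)
      (lower⇒onUpperSheet≡false (≡mod-trans (-‿cong-mod I≡n+r) (neg-upper (ℕ.<⇒≤ r<n)))
                                (ℕ.∸-monoʳ-< ℕ.z<s (ℕ.<⇒≤ r<n)))
      (σ₂-column-suc (toℕ-reduce (≡mod-trans (≡mod-2n⇒≡mod-n I≡n+r) (n+r≡r (suc r))) r<n) (reduce-represents (mirror J)))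
      (≡mod-trans (reduce-represents _)
                  (≡⇒≡mod (trans (cong (λ x → mirror J - x) (χ-upper I≡n+r)) (ring (mirror J) (χ (+ suc r))))))
      where ring : ∀ y x → y - - x ≡ y + x
            ring = solve-∀

    σ₂-lift : ∀ I J → σ₂ n m (π I J) ≡ π (- I) (mirror J - χ I)
    σ₂-lift I J = cong₂ _,_ (refl'-reduce I) (σ₂-lift-row J (sheet I))

    _·σ₂ : Affine → Affine
    affine ε a δ u v ·σ₂ = affine (not ε) (- a) (not δ) (- u - expand₀ ε (reduce a)) (- v - expand₁ ε (reduce a))

    ⟦⟧-·σ₂ : ∀ p → (⟦ p ⟧ · σ₂ n m) ≈ ⟦ p ·σ₂ ⟧
    ⟦⟧-·σ₂ p@(affine ε a δ u v) (i , j) =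
      trans (σ₂-lift (column p I) (height p I J)) (π-cong (≡⇒≡mod column-eq) (≡⇒≡mod height-eq))
      where
        open ≡-Reasoning
        I J A B : ℤ
        I = + toℕ i
        J = + toℕ j
        A = expand₀ ε (reduce a)
        B = expand₁ ε (reduce a)
        column-eq : - (sign ε * I + a) ≡ sign (not ε) * I + - a
        column-eq = trans (ring (sign ε) I a) (cong (λ x → x * I + - a) (sym (sign-not ε)))
          where ring : ∀ s I a → - (s * I + a) ≡ - s * I + - a
                ring = solve-∀
        height-eq : mirror (height p I J) - χ (sign ε * I + a) ≡ height (p ·σ₂) I J
        height-eq = begin
          mirror (height p I J) - χ (sign ε * I + a)
            ≡⟨ cong₂ _-_ (sym (height-not ε a δ u v I J)) (χ-affine ε a I) ⟩
          sign (not δ) * J + κ (not δ) + - u * χ I + - v * χ (I + + 1) - (A * χ I + B * χ (I + + 1))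
            ≡⟨ ring (sign (not δ)) (κ (not δ)) J u v A B (χ I) (χ (I + + 1)) ⟩
          height (p ·σ₂) I J ∎
          where ring : ∀ s k J u v A B x y →
                  s * J + k + - u * x + - v * y - (A * x + B * y) ≡ s * J + k + (- u - A) * x + (- v - B) * y
                ring = solve-∀

-- Writing n = 3 + k and m = 3 + 2h makes 0F and 1F elements of Fin n and Fin m by definition.
module Group (k h : ℕ) (n%4≡2 : (3 ℕ.+ k) ℕ.% 4 ≡ 2) where

  open import Data.Integer using (ℤ; +_; _+_; _*_; -_; _-_; _%ℕ_)

  n m : ℕ
  n = 3 ℕ.+ k
  m = 3 ℕ.+ 2 ℕ.* h

  open Cover n m
  open σ₂-Cover n%4≡2

  3≤n : 3 ℕ.≤ n
  3≤n = ℕ.s≤s (ℕ.s≤s (ℕ.s≤s ℕ.z≤n))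

  3≤m : 3 ℕ.≤ m
  3≤m = ℕ.s≤s (ℕ.s≤s (ℕ.s≤s ℕ.z≤n))

  columns-determine : ∀ p p′ → ⟦ p ⟧ ≈ ⟦ p′ ⟧ → (Affine.ε p ≡ Affine.ε p′) × (Affine.a p ≡ Affine.a p′ mod n)
  columns-determine p@(affine ε a _ _ _) p′@(affine ε′ a′ _ _ _) p≈p′ = sign-injective 3≤n ε ε′ (begin
    sign ε                                       ≡⟨ ring (sign ε) a ⟩
    (sign ε * + 1 + a) - (sign ε * + 0 + a)      ≈⟨ +-cong-mod column₁ (-‿cong-mod column₀) ⟩
    (sign ε′ * + 1 + a′) - (sign ε′ * + 0 + a′)  ≡⟨ ring (sign ε′) a′ ⟨
    sign ε′                                      ∎) , (begin
    a                   ≡⟨ ring₀ (sign ε) a ⟩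
    sign ε * + 0 + a    ≈⟨ column₀ ⟩
    sign ε′ * + 0 + a′  ≡⟨ ring₀ (sign ε′) a′ ⟨
    a′                  ∎)
    where
      open import Relation.Binary.Reasoning.Setoid (≡mod-setoid {n})
      column₀ : sign ε * + 0 + a ≡ sign ε′ * + 0 + a′ mod n
      column₀ = ⟦⟧-column p p′ p≈p′ 0F 0F
      column₁ : sign ε * + 1 + a ≡ sign ε′ * + 1 + a′ mod n
      column₁ = ⟦⟧-column p p′ p≈p′ 1F 0F
      ring : ∀ s a → s ≡ (s * + 1 + a) - (s * + 0 + a)
      ring = solve-∀
      ring₀ : ∀ s a → a ≡ s * + 0 + a
      ring₀ = solve-∀

  heights-determine : ∀ p p′ → ⟦ p ⟧ ≈ ⟦ p′ ⟧ → Affine.ε p ≡ Affine.ε p′ → Affine.a p ≡ Affine.a p′ mod 2n →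
                      (Affine.δ p ≡ Affine.δ p′) × (Affine.u p ≡ Affine.u p′ mod m) × (Affine.v p ≡ Affine.v p′ mod m)
  heights-determine p@(affine ε a δ u v) p′@(affine _ a′ δ′ u′ v′) p≈p′ refl a≡a′ = δ≡δ′ , coefficients δ≡δ′
    where
      open import Relation.Binary.Reasoning.Setoid (≡mod-setoid {m})
      height-at : ∀ i j → height p (+ toℕ i) (+ toℕ j) ≡ height p′ (+ toℕ i) (+ toℕ j) mod m
      height-at i j = ⟦⟧-height p p′ p≈p′ i j (+-cong-mod (≡mod-refl {a = sign ε * + toℕ i}) a≡a′)
      δ≡δ′ : δ ≡ δ′
      δ≡δ′ = sign-injective 3≤m δ δ′ (begin
        sign δ
          ≡⟨ ring (sign δ) (κ δ) u v ⟩
        (sign δ * + 1 + κ δ + u * - + 1 + v * - + 1) - (sign δ * + 0 + κ δ + u * - + 1 + v * - + 1)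
          ≈⟨ +-cong-mod (height-at 0F 1F) (-‿cong-mod (height-at 0F 0F)) ⟩
        (sign δ′ * + 1 + κ δ′ + u′ * - + 1 + v′ * - + 1) - (sign δ′ * + 0 + κ δ′ + u′ * - + 1 + v′ * - + 1)
          ≡⟨ ring (sign δ′) (κ δ′) u′ v′ ⟨
        sign δ′ ∎)
        where ring : ∀ s k u v → s ≡ (s * + 1 + k + u * - + 1 + v * - + 1) - (s * + 0 + k + u * - + 1 + v * - + 1)
              ring = solve-∀
      coefficients : δ ≡ δ′ → (u ≡ u′ mod m) × (v ≡ v′ mod m)
      coefficients refl = halve h (begin
        + 2 * u
          ≡⟨ ring-u (sign δ) (κ δ) u v ⟩
        - ((sign δ * + 0 + κ δ + u * - + 1 + v * - + 1) + (sign δ * + 0 + κ δ + u * - + 1 + v * + 1)) + + 2 * κ δ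
          ≈⟨ +-cong-mod (-‿cong-mod (+-cong-mod (height-at 0F 0F) (height-at 1F 0F))) ≡mod-refl ⟩
        - ((sign δ * + 0 + κ δ + u′ * - + 1 + v′ * - + 1) + (sign δ * + 0 + κ δ + u′ * - + 1 + v′ * + 1)) + + 2 * κ δ
          ≡⟨ ring-u (sign δ) (κ δ) u′ v′ ⟨
        + 2 * u′ ∎) , halve h (begin
        + 2 * v
          ≡⟨ ring-v (sign δ) (κ δ) u v ⟩
        (sign δ * + 0 + κ δ + u * - + 1 + v * + 1) - (sign δ * + 0 + κ δ + u * - + 1 + v * - + 1)
          ≈⟨ +-cong-mod (height-at 1F 0F) (-‿cong-mod (height-at 0F 0F)) ⟩
        (sign δ * + 0 + κ δ + u′ * - + 1 + v′ * + 1) - (sign δ * + 0 + κ δ + u′ * - + 1 + v′ * - + 1)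
          ≡⟨ ring-v (sign δ) (κ δ) u′ v′ ⟨
        + 2 * v′ ∎)
        where ring-u : ∀ s k u v → + 2 * u ≡
                         - ((s * + 0 + k + u * - + 1 + v * - + 1) + (s * + 0 + k + u * - + 1 + v * + 1)) + + 2 * k
              ring-u = solve-∀
              ring-v : ∀ s k u v → + 2 * v ≡ (s * + 0 + k + u * - + 1 + v * + 1) - (s * + 0 + k + u * - + 1 + v * - + 1)
              ring-v = solve-∀

  Normal : Set
  Normal = ((Bool × Bool) × (Fin m × Fin m)) × Fin n

  fromNormal : Normal → Affine
  fromNormal (((ε , δ) , (u , v)) , a) = affine ε (+ toℕ a) δ (+ toℕ u) (+ toℕ v)

  fromNormal-injective : ∀ x y → ⟦ fromNormal x ⟧ ≈ ⟦ fromNormal y ⟧ → x ≡ y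
  fromNormal-injective x@(((ε , δ) , (u , v)) , a) y@(((ε′ , δ′) , (u′ , v′)) , a′) x≈y
    with columns-determine (fromNormal x) (fromNormal y) x≈y
  ... | refl , a≡a′ with residue-injective a≡a′
  ... | refl with heights-determine (fromNormal x) (fromNormal y) x≈y refl ≡mod-refl
  ... | refl , u≡u′ , v≡v′ = cong₂ (λ u v → ((ε , δ) , (u , v)) , a) (residue-injective u≡u′) (residue-injective v≡v′)

  normalise : ∀ p → ∃ λ x → ⟦ p ⟧ ≈ ⟦ fromNormal x ⟧
  normalise (affine ε a δ u v) with sheet a
  ... | lower r<n a≡r = (((ε , δ) , (reduce u , reduce v)) , fromℕ< r<n) ,
          ⟦⟧-cong ε δ (≡mod-trans a≡r (≡⇒≡mod (cong +_ (sym (Fin.toℕ-fromℕ< r<n)))))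
                      (≡mod-sym (reduce-represents u)) (≡mod-sym (reduce-represents v))
  ... | upper {r} r<n a≡n+r = x , λ w → trans (⟦⟧-cong ε δ a≡ (negated u) (negated v) w)
          (trans (cong (λ d → ⟦ affine ε (A + + n) d (- U) (- V) ⟧ w) (sym (not-involutive δ)))
                 (⟦deck⟧ (fromNormal x) w))
    where
      x : Normal
      x = ((ε , not δ) , (reduce (- u) , reduce (- v))) , fromℕ< r<n
      A U V : ℤ
      A = + toℕ (fromℕ< r<n)
      U = + toℕ (reduce {m} (- u))
      V = + toℕ (reduce {m} (- v))
      a≡ : a ≡ A + + n mod 2n
      a≡ = ≡mod-trans a≡n+r (≡⇒≡mod (trans (ℤ.pos-+ n r)
             (trans (ℤ.+-comm (+ n) (+ r)) (cong (λ k → + k + + n) (sym (Fin.toℕ-fromℕ< r<n))))))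
      negated : ∀ y → y ≡ - + toℕ (reduce {m} (- y)) mod m
      negated y = subst (λ z → z ≡ - + toℕ (reduce {m} (- y)) mod m) (ℤ.neg-involutive y)
                        (-‿cong-mod (≡mod-sym (reduce-represents (- y))))

  generated-affine : ∀ {f} → Gen (σ₁ n m) (σ₂ n m) f → ∃ λ p → f ≈ ⟦ p ⟧
  generated-affine gen-id = identity , λ w → sym (⟦identity⟧ w)
  generated-affine (gen-₁ g) with generated-affine g
  ... | p , f≈p = p ·σ₁ , λ w → trans (cong (σ₁ n m) (f≈p w)) (⟦⟧-·σ₁ p w)
  generated-affine (gen-₂ g) with generated-affine g
  ... | p , f≈p = p ·σ₂ , λ w → trans (cong (σ₂ n m) (f≈p w)) (⟦⟧-·σ₂ p w)

  record Reachable (p : Affine) : Set where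
    constructor reached
    field
      element   : Perm n m
      generated : Gen (σ₁ n m) (σ₂ n m) element
      realises  : element ≈ ⟦ p ⟧

  reachable-≈ : ∀ {p p′} → ⟦ p ⟧ ≈ ⟦ p′ ⟧ → Reachable p → Reachable p′
  reachable-≈ p≈p′ (reached f g f≈p) = reached f g λ w → trans (f≈p w) (p≈p′ w)

  reachable-identity : Reachable identity
  reachable-identity = reached idP gen-id λ w → sym (⟦identity⟧ w)

  reachable-·σ₁ : ∀ {p} → Reachable p → Reachable (p ·σ₁)
  reachable-·σ₁ {p} (reached f g f≈p) =
    reached (f · σ₁ n m) (gen-₁ g) λ w → trans (cong (σ₁ n m) (f≈p w)) (⟦⟧-·σ₁ p w)

  reachable-·σ₂ : ∀ {p} → Reachable p → Reachable (p ·σ₂)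
  reachable-·σ₂ {p} (reached f g f≈p) =
    reached (f · σ₂ n m) (gen-₂ g) λ w → trans (cong (σ₂ n m) (f≈p w)) (⟦⟧-·σ₂ p w)

  reachable-shift : ∀ k {ε a δ u v} → Reachable (affine ε a δ u v) → Reachable (affine ε (a + + k) δ u v)
  reachable-shift zero    {ε} {a} {δ} {u} {v} R =
    reachable-≈ (⟦⟧-cong ε δ (≡⇒≡mod (sym (ℤ.+-identityʳ a))) (≡mod-refl {a = u}) (≡mod-refl {a = v})) R
  reachable-shift (suc k) {ε} {a} {δ} {u} {v} R = reachable-≈
    (⟦⟧-cong ε δ (≡⇒≡mod (trans (ℤ.+-assoc a (+ k) (+ 1)) (cong (λ x → a + x) (sym (pos-suc k)))))
                 (≡mod-refl {a = u}) (≡mod-refl {a = v}))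
    (reachable-·σ₁ (reachable-shift k R))

  columnwise : ℤ → ℤ → Affine
  columnwise U V = affine true (+ 0) true U V

  columnwise-cong : ∀ {U U′ V V′} → U ≡ U′ mod m → V ≡ V′ mod m → ⟦ columnwise U V ⟧ ≈ ⟦ columnwise U′ V′ ⟧
  columnwise-cong = ⟦⟧-cong true true ≡mod-refl

  columnwise-·σ₂·σ₂ : ∀ U V → ⟦ columnwise U V ·σ₂ ·σ₂ ⟧ ≈ ⟦ columnwise (U + + 1) (V + - + 1) ⟧
  columnwise-·σ₂·σ₂ U V = columnwise-cong (≡⇒≡mod (ring-u U)) (≡⇒≡mod (ring-v V))
    where ring-u : ∀ U → - (- U - + 1) - + 0 ≡ U + + 1
          ring-u = solve-∀
          ring-v : ∀ V → - (- V - + 0) - + 1 ≡ V + - + 1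
          ring-v = solve-∀

  reachable-[u+1,v-1] : ∀ {U V} → Reachable (columnwise U V) → Reachable (columnwise (U + + 1) (V + - + 1))
  reachable-[u+1,v-1] {U} {V} R = reachable-≈ (columnwise-·σ₂·σ₂ U V) (reachable-·σ₂ (reachable-·σ₂ R))

  reachable-[u+1,v+1] : ∀ {U V} → Reachable (columnwise U V) → Reachable (columnwise (U + + 1) (V + + 1))
  reachable-[u+1,v+1] {U} {V} R =
    reachable-≈ (⟦⟧-cong true true 1+[2n-1]≡0 (≡⇒≡mod (ring-u U)) (≡⇒≡mod (ring-v V)))
                (reachable-shift (2n ℕ.∸ 1) (reachable-·σ₂ (reachable-·σ₂ (reachable-·σ₁ R))))
    where ring-u : ∀ U → - (- U - + 0) - - + 1 ≡ U + + 1
          ring-u = solve-∀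
          ring-v : ∀ V → - (- V - + 1) - + 0 ≡ V + + 1
          ring-v = solve-∀
          1+[2n-1]≡0 : + 1 + + (2n ℕ.∸ 1) ≡ + 0 mod 2n
          1+[2n-1]≡0 = ≡mod-trans
            (≡⇒≡mod (trans (sym (ℤ.pos-+ 1 _)) (cong +_ (ℕ.m+[n∸m]≡n {1} {2n} (ℕ.s≤s ℕ.z≤n))))) 2n≡0

  iterate : ∀ s → (∀ {U V} → Reachable (columnwise U V) → Reachable (columnwise (U + + 1) (V + s))) →
            ∀ k {U V} → Reachable (columnwise U V) → Reachable (columnwise (U + + k) (V + + k * s))
  iterate s step zero    {U} {V} R = reachable-≈ (columnwise-cong (≡⇒≡mod (ring-u U)) (≡⇒≡mod (ring-v V s))) R
    where ring-u : ∀ U → U ≡ U + + 0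
          ring-u = solve-∀
          ring-v : ∀ V s → V ≡ V + + 0 * s
          ring-v = solve-∀
  iterate s step (suc k) {U} {V} R = reachable-≈
    (columnwise-cong (≡⇒≡mod (trans (ring-u U (+ k)) (cong (λ x → U + x) (sym (pos-suc k)))))
                     (≡⇒≡mod (trans (ring-v V (+ k) s) (cong (λ x → V + x * s) (sym (pos-suc k))))))
    (step (iterate s step k R))
    where ring-u : ∀ U k → U + k + + 1 ≡ U + (k + + 1)
          ring-u = solve-∀
          ring-v : ∀ V k s → V + k * s + s ≡ V + (k + + 1) * s
          ring-v = solve-∀

  -- k₋ steps of (1, −1) followed by k₊ steps of (1, 1), where k∓ ≡ (U ∓ V) / 2 (mod m).
  reachable-columnwise : ∀ U V → Reachable (columnwise U V)
  reachable-columnwise U V = reachable-≈ (columnwise-cong U≡ V≡)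
    (iterate (+ 1) reachable-[u+1,v+1] k₊ (iterate (- + 1) reachable-[u+1,v-1] k₋ reachable-identity))
    where
      open import Relation.Binary.Reasoning.Setoid (≡mod-setoid {m})
      ½ : ℤ
      ½ = + (2 ℕ.+ h)
      k₋ k₊ : ℕ
      k₋ = ((U - V) * ½) %ℕ m
      k₊ = ((U + V) * ½) %ℕ m
      U≡ : + 0 + + k₋ + + k₊ ≡ U mod m
      U≡ = begin
        + 0 + + k₋ + + k₊                ≈⟨ +-cong-mod (+-cong-mod (≡mod-refl {a = + 0}) (%ℕ-≡mod ((U - V) * ½)))
                                                       (%ℕ-≡mod ((U + V) * ½)) ⟩
        + 0 + (U - V) * ½ + (U + V) * ½  ≡⟨ ring U V ½ ⟩
        + 2 * ½ * U                      ≈⟨ *-cong-mod (2*[2+h]≡1 h) (≡mod-refl {a = U}) ⟩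
        + 1 * U                          ≡⟨ ℤ.*-identityˡ U ⟩
        U                                ∎
        where ring : ∀ U V t → + 0 + (U - V) * t + (U + V) * t ≡ + 2 * t * U
              ring = solve-∀
      V≡ : + 0 + + k₋ * - + 1 + + k₊ * + 1 ≡ V mod m
      V≡ = begin
        + 0 + + k₋ * - + 1 + + k₊ * + 1
          ≈⟨ +-cong-mod (+-cong-mod (≡mod-refl {a = + 0}) (*-cong-mod (%ℕ-≡mod ((U - V) * ½)) (≡mod-refl {a = - + 1})))
                        (*-cong-mod (%ℕ-≡mod ((U + V) * ½)) (≡mod-refl {a = + 1})) ⟩
        + 0 + (U - V) * ½ * - + 1 + (U + V) * ½ * + 1
          ≡⟨ ring U V ½ ⟩
        + 2 * ½ * V
          ≈⟨ *-cong-mod (2*[2+h]≡1 h) (≡mod-refl {a = V}) ⟩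
        + 1 * V
          ≡⟨ ℤ.*-identityˡ V ⟩
        V ∎
        where ring : ∀ U V t → + 0 + (U - V) * t * - + 1 + (U + V) * t * + 1 ≡ + 2 * t * V
              ring = solve-∀

  reachable-column : ∀ a U V → Reachable (affine true a true U V)
  reachable-column a U V = reachable-≈
    (⟦⟧-cong true true (≡mod-trans (≡⇒≡mod (ℤ.+-identityˡ _)) (%ℕ-≡mod a)) (≡mod-refl {a = U}) (≡mod-refl {a = V}))
    (reachable-shift (a %ℕ 2n) (reachable-columnwise U V))

  reachable-orientation : ∀ δ a U V → Reachable (affine true a δ U V)
  reachable-orientation true  a U V = reachable-column a U V
  reachable-orientation false a U V = reachable-≈
    (λ w → trans (sym (⟦deck⟧ (affine true (a - + n) true (- U) (- V)) w))
                 (⟦⟧-cong true false (≡⇒≡mod (ring a (+ n))) (≡⇒≡mod (ℤ.neg-involutive U))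
                                     (≡⇒≡mod (ℤ.neg-involutive V)) w))
    (reachable-column (a - + n) (- U) (- V))
    where ring : ∀ a n → a - n + n ≡ a
          ring = solve-∀

  reachable : ∀ p → Reachable p
  reachable (affine true  a δ U V) = reachable-orientation δ a U V
  reachable (affine false a δ U V) = reachable-≈ (undo δ) (reachable-·σ₂ (reachable-orientation (not δ) (- a) U′ V′))
    where
      α β U′ V′ : ℤ
      α = expand₀ true (reduce (- a))
      β = expand₁ true (reduce (- a))
      U′ = - U - α
      V′ = - V - β
      ring : ∀ U α → - (- U - α) - α ≡ U
      ring = solve-∀
      undo : ∀ δ → ⟦ affine true (- a) (not δ) U′ V′ ·σ₂ ⟧ ≈ ⟦ affine false a δ U V ⟧
      undo true  = ⟦⟧-cong false true  (≡⇒≡mod (ℤ.neg-involutive a)) (≡⇒≡mod (ring U α)) (≡⇒≡mod (ring V β))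
      undo false = ⟦⟧-cong false false (≡⇒≡mod (ℤ.neg-involutive a)) (≡⇒≡mod (ring U α)) (≡⇒≡mod (ring V β))

  Fin↔Normal : Fin (4 ℕ.* (m ℕ.* m) ℕ.* n) ↔ Normal
  Fin↔Normal = ↔-trans *↔× (↔-trans *↔× (↔-trans *↔× (2↔Bool ×-↔ 2↔Bool) ×-↔ *↔×) ×-↔ ↔-refl)

  |G|≡4m²n : HasCard (Gen (σ₁ n m) (σ₂ n m)) (4 ℕ.* (m ℕ.* m) ℕ.* n)
  |G|≡4m²n = hasCard-via (⟦_⟧ ∘ fromNormal) Fin↔Normal fromNormal-injective
    (λ x → let open Reachable (reachable (fromNormal x)) in element , generated , realises)
    (λ f g → let (p , f≈p) = generated-affine g ; (x , p≈x) = normalise p in x , λ w → trans (f≈p w) (p≈x w))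

  orientation-reversing-nontrivial : ∀ p → Affine.ε p ≡ false → ¬ ⟦ p ⟧ ≈ ⟦ identity ⟧
  orientation-reversing-nontrivial p ε≡false p≈id =
    contradiction (trans (sym (proj₁ (columns-determine p identity p≈id))) ε≡false) λ ()

  translation : ℤ → Affine
  translation a = affine true a true (+ 0) (+ 0)

  translation-trivial : ∀ a → ⟦ translation a ⟧ ≈ ⟦ identity ⟧ → a ≡ + 0 mod 2n
  translation-trivial a a≈id with sheet a | proj₂ (columns-determine (translation a) identity a≈id)
  ... | lower {r} r<n a≡r | a≡0 = subst (λ r → a ≡ + r mod 2n) r≡0 a≡r
    where r≡0 : r ≡ 0
          r≡0 = ≡mod⇒≡ r<n 0<n (≡mod-trans (≡mod-sym (≡mod-2n⇒≡mod-n a≡r)) a≡0)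
  ... | upper {r} r<n a≡n+r | a≡0 = contradiction (proj₁ (heights-determine p identity p≈id refl a-n≡0)) λ ()
    where
      r≡0 : r ≡ 0
      r≡0 = ≡mod⇒≡ r<n 0<n
        (≡mod-trans (≡mod-sym (n+r≡r r)) (≡mod-trans (≡mod-sym (≡mod-2n⇒≡mod-n a≡n+r)) a≡0))
      ring₁ : ∀ a n → a - n + n ≡ a
      ring₁ = solve-∀
      ring₂ : ∀ n → n + + 0 - n ≡ + 0
      ring₂ = solve-∀
      p : Affine
      p = affine true (a - + n) false (+ 0) (+ 0)
      p≈id : ⟦ p ⟧ ≈ ⟦ identity ⟧
      p≈id w = trans (sym (⟦deck⟧ p w))
        (trans (⟦⟧-cong true true (≡⇒≡mod (ring₁ a (+ n))) (≡mod-refl {a = + 0}) (≡mod-refl {a = + 0}) w) (a≈id w))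
      a-n≡0 : a - + n ≡ + 0 mod 2n
      a-n≡0 = ≡mod-trans (+-cong-mod a≡n+r (≡mod-refl {a = - + n}))
        (≡⇒≡mod (trans (cong (λ x → + (n ℕ.+ x) - + n) r≡0) (trans (cong (_- + n) (ℤ.pos-+ n 0)) (ring₂ (+ n)))))

  realises-idP : ∀ {f} p → f ≈ ⟦ p ⟧ → f ≈ idP → ⟦ p ⟧ ≈ ⟦ identity ⟧
  realises-idP _ f≈p f≈id w = trans (sym (f≈p w)) (trans (f≈id w) (sym (⟦identity⟧ w)))

  σ₁-power : ∀ k → (σ₁ n m ^ k) ≈ ⟦ translation (+ k) ⟧
  σ₁-power zero    w = sym (⟦identity⟧ w)
  σ₁-power (suc k) w = trans (cong (σ₁ n m) (σ₁-power k w)) (trans (⟦⟧-·σ₁ (translation (+ k)) w)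
    (⟦⟧-cong true true (≡⇒≡mod (sym (pos-suc k))) (≡mod-refl {a = + 0}) (≡mod-refl {a = + 0}) w))

  σ₁-order : HasOrder (σ₁ n m) (2 ℕ.* n)
  σ₁-order = ℕ.z<s , σ₁^2n≈id , nontrivial
    where
      2*n≡2n : 2 ℕ.* n ≡ 2n
      2*n≡2n = cong (n ℕ.+_) (ℕ.+-identityʳ n)
      2*n≡0 : + (2 ℕ.* n) ≡ + 0 mod 2n
      2*n≡0 = subst (λ x → + x ≡ + 0 mod 2n) (sym 2*n≡2n) 2n≡0
      σ₁^2n≈id : (σ₁ n m ^ (2 ℕ.* n)) ≈ idP
      σ₁^2n≈id w = trans (σ₁-power (2 ℕ.* n) w)
        (trans (⟦⟧-cong true true 2*n≡0 (≡mod-refl {a = + 0}) (≡mod-refl {a = + 0}) w) (⟦identity⟧ w))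
      nontrivial : ∀ j → 0 ℕ.< j → j ℕ.< 2 ℕ.* n → ¬ (σ₁ n m ^ j) ≈ idP
      nontrivial j 0<j j<2n σ₁ʲ≈id = ℕ.<⇒≢ 0<j (sym (≡mod⇒≡ (subst (j ℕ.<_) 2*n≡2n j<2n) ℕ.z<s
        (translation-trivial (+ j) (realises-idP (translation (+ j)) (σ₁-power j) σ₁ʲ≈id))))

  σ₂-power-even : ∀ k → (σ₂ n m ^ (k ℕ.+ k)) ≈ ⟦ columnwise (+ k) (- + k) ⟧
  σ₂-power-even zero    w = sym (⟦identity⟧ w)
  σ₂-power-even (suc k) w = begin
    (σ₂ n m ^ suc (k ℕ.+ suc k)) w              ≡⟨ cong (λ j → (σ₂ n m ^ suc j) w) (ℕ.+-suc k k) ⟩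
    σ₂ n m (σ₂ n m ((σ₂ n m ^ (k ℕ.+ k)) w))    ≡⟨ cong (σ₂ n m ∘ σ₂ n m) (σ₂-power-even k w) ⟩
    σ₂ n m (σ₂ n m (⟦ columnwise K (- K) ⟧ w))  ≡⟨ cong (σ₂ n m) (⟦⟧-·σ₂ (columnwise K (- K)) w) ⟩
    σ₂ n m (⟦ columnwise K (- K) ·σ₂ ⟧ w)       ≡⟨ ⟦⟧-·σ₂ (columnwise K (- K) ·σ₂) w ⟩
    ⟦ columnwise K (- K) ·σ₂ ·σ₂ ⟧ w            ≡⟨ columnwise-·σ₂·σ₂ K (- K) w ⟩
    ⟦ columnwise (K + + 1) (- K + - + 1) ⟧ w    ≡⟨ columnwise-cong (≡⇒≡mod (sym (pos-suc k)))
                                                    (≡⇒≡mod (trans (ring K) (cong -_ (sym (pos-suc k))))) w ⟩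
    ⟦ columnwise (+ suc k) (- + suc k) ⟧ w      ∎
    where open ≡-Reasoning
          K : ℤ
          K = + k
          ring : ∀ k → - k + - + 1 ≡ - (k + + 1)
          ring = solve-∀

  σ₂-power-odd : ∀ k → (σ₂ n m ^ suc (k ℕ.+ k)) ≈ ⟦ columnwise (+ k) (- + k) ·σ₂ ⟧
  σ₂-power-odd k w = trans (cong (σ₂ n m) (σ₂-power-even k w)) (⟦⟧-·σ₂ (columnwise (+ k) (- + k)) w)

  σ₂-order : HasOrder (σ₂ n m) (2 ℕ.* m)
  σ₂-order = ℕ.z<s , σ₂^2m≈id , nontrivial
    where
      2*m≡m+m : 2 ℕ.* m ≡ m ℕ.+ m
      2*m≡m+m = cong (m ℕ.+_) (ℕ.+-identityʳ m)
      ring₁ : ∀ m → m ≡ + 0 + + 1 * m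
      ring₁ = solve-∀
      ring₂ : ∀ m → - m ≡ + 0 + - + 1 * m
      ring₂ = solve-∀
      σ₂^2m≈id : (σ₂ n m ^ (2 ℕ.* m)) ≈ idP
      σ₂^2m≈id w = trans (cong (λ j → (σ₂ n m ^ j) w) 2*m≡m+m) (trans (σ₂-power-even m w)
        (trans (columnwise-cong {U′ = + 0} {V′ = + 0} (+ 1 , ring₁ (+ m)) (- + 1 , ring₂ (+ m)) w) (⟦identity⟧ w)))
      nontrivial : ∀ j → 0 ℕ.< j → j ℕ.< 2 ℕ.* m → ¬ (σ₂ n m ^ j) ≈ idP
      nontrivial j 0<j j<2m σ₂ʲ≈id with even⊎odd j
      ... | k , inj₁ refl = ℕ.<⇒≢ 0<j (cong (λ x → x ℕ.+ x) (sym k≡0))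
        where
          k<m : k ℕ.< m
          k<m = ℕ.≰⇒> λ m≤k → ℕ.<⇒≱ (subst (k ℕ.+ k ℕ.<_) 2*m≡m+m j<2m) (ℕ.+-mono-≤ m≤k m≤k)
          k≡0 : k ≡ 0
          k≡0 = ≡mod⇒≡ k<m ℕ.z<s (proj₁ (proj₂ (heights-determine (columnwise (+ k) (- + k)) identity
                  (realises-idP (columnwise (+ k) (- + k)) (σ₂-power-even k) σ₂ʲ≈id) refl ≡mod-refl)))
      ... | k , inj₂ refl = orientation-reversing-nontrivial (columnwise (+ k) (- + k) ·σ₂) refl
                              (realises-idP (columnwise (+ k) (- + k) ·σ₂) (σ₂-power-odd k) σ₂ʲ≈id)

  σ₁σ₂-order : HasOrder (σ₁ n m · σ₂ n m) 2
  σ₁σ₂-order = ℕ.z<s , σ²≈id , nontrivial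
    where
      σ : Perm n m
      σ = σ₁ n m · σ₂ n m
      ρ : Affine
      ρ = identity ·σ₁ ·σ₂
      ⟦⟧-·σ : ∀ p → (⟦ p ⟧ · σ) ≈ ⟦ p ·σ₁ ·σ₂ ⟧
      ⟦⟧-·σ p w = trans (cong (σ₂ n m) (⟦⟧-·σ₁ p w)) (⟦⟧-·σ₂ (p ·σ₁) w)
      σ≈ρ : (σ ^ 1) ≈ ⟦ ρ ⟧
      σ≈ρ w = trans (cong σ (sym (⟦identity⟧ w))) (⟦⟧-·σ identity w)
      σ²≈id : (σ ^ 2) ≈ idP
      σ²≈id w = trans (cong σ (σ≈ρ w)) (trans (⟦⟧-·σ ρ w) (⟦identity⟧ w))
      nontrivial : ∀ j → 0 ℕ.< j → j ℕ.< 2 → ¬ (σ ^ j) ≈ idP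
      nontrivial 1 _ _ σ≈id = orientation-reversing-nontrivial ρ refl (realises-idP ρ σ≈ρ σ≈id)
      nontrivial (suc (suc _)) _ (ℕ.s≤s (ℕ.s≤s ()))

open import Data.Nat using (ℕ; _≤_; _<_; _*_; _+_; _%_)
open import Data.Nat.Divisibility using (_∣_)
open import Data.Product using (_×_)
open import Relation.Nullary using (¬_)

odd⇒≡3+2* : ∀ m → 3 ≤ m → ¬ (2 ∣ m) → ∃ λ h → m ≡ 3 + 2 * h
odd⇒≡3+2* m 3≤m 2∤m with even⊎odd m
... | k     , inj₁ m≡k+k = contradiction (divides k (trans m≡k+k (ring k))) 2∤m
  where ring : ∀ k → k + k ≡ k * 2
        ring = ℕ-Solver.solve-∀
... | zero  , inj₂ refl = contradiction 3≤m λ { (ℕ.s≤s ()) }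
... | suc h , inj₂ refl = h , ring h
  where ring : ∀ h → suc (suc h + suc h) ≡ 3 + 2 * h
        ring = ℕ-Solver.solve-∀

even∧4∤⇒≡2+4* : ∀ s → 2 ∣ s → ¬ (4 ∣ s) → ∃ λ u → s ≡ 2 + 4 * u
even∧4∤⇒≡2+4* s (divides t s≡2t) 4∤s with even⊎odd t
... | k , inj₁ refl = contradiction (divides k (trans s≡2t (ring k))) 4∤s
  where ring : ∀ k → (k + k) * 2 ≡ k * 4
        ring = ℕ-Solver.solve-∀
... | k , inj₂ refl = k , trans s≡2t (ring k)
  where ring : ∀ k → suc (k + k) * 2 ≡ 2 + 4 * k
        ring = ℕ-Solver.solve-∀

lemma5p4 : (m s : ℕ) → 3 ≤ m → ¬ (2 ∣ m) → 0 < s → 2 ∣ s → ¬ (4 ∣ s) →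
    HasOrder (σ₁ (s * m) m) (2 * (s * m)) ×
    HasOrder (σ₂ (s * m) m) (2 * m) ×
    HasOrder (σ₁ (s * m) m · σ₂ (s * m) m) 2 ×
    HasCard (Gen (σ₁ (s * m) m) (σ₂ (s * m) m)) (4 * (m * m) * (s * m))
lemma5p4 m s 3≤m 2∤m _ 2∣s 4∤s with odd⇒≡3+2* m 3≤m 2∤m | even∧4∤⇒≡2+4* s 2∣s 4∤s
... | h , refl | u , refl = σ₁-order , σ₂-order , σ₁σ₂-order , |G|≡4m²n
  where
    sm%4≡2 : ((2 + 4 * u) * (3 + 2 * h)) % 4 ≡ 2
    sm%4≡2 = trans (cong (_% 4) (ring u h)) (ℕ.[m+kn]%n≡m%n 2 (1 + h + 3 * u + 2 * u * h) 4)
      where ring : ∀ u h → (2 + 4 * u) * (3 + 2 * h) ≡ 2 + (1 + h + 3 * u + 2 * u * h) * 4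
            ring = ℕ-Solver.solve-∀
    -- With this k, 3 + k reduces to s * m = (2 + 4u)(3 + 2h).
    open Group (2 * h + (1 + 4 * u) * (3 + 2 * h)) h sm%4≡2
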